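{- Let $n\ge4$ be even and $1\le j\le n-1$. The map $\nu_j:Y_1\to Y_j$, $x\mapsto\sigma_jx\sigma_j^{ -1}$, is a bijection which is order-preserving for the Bruhat order (if $x\le y$ then $\nu_j(x)\le\nu_j(y)$).
   Context: $S_n$ symmetric group, $s_i=(i,i+1)$, $\ell$ length; $\mathcal F_m$ fixed-point-free involutions of $S_m$. The Bruhat order on $\mathcal F_n$ is the weakest partial order with $z\le tzt$ for every transposition $t$ with $\ell(z)\le\ell(tzt)$. View $S_{n-2}\subset S_n$ fixing $n-1,n$; $w_0$ longest element of $S_n$; $\rho_n(z)=w_0zs_{n-1}w_0$ for $z\in\mathcal F_{n-2}$; $\sigma_i=s_is_{i-1}\cdots s_1$; $Y_1=\rho_n(\mathcal F_{n-2})$, $Y_j=\sigma_jY_1\sigma_j^{ -1}$. -}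

module Defs where

open import Data.Nat as ℕ using (ℕ; zero; suc; _≤_; _<_)
open import Data.Nat.Properties using (<⇒≤)
open import Data.Fin as F using (Fin; toℕ; fromℕ<; inject₁; opposite; splitAt; _↑ˡ_; _↑ʳ_)
open import Data.Fin.Permutation.Components using (transpose)
open import Data.Vec using (Vec; lookup; tabulate)
open import Data.List using (List; length; filter; cartesianProduct; allFin)
open import Data.List.Base using () renaming (map to lmap)
open import Data.Fin using () renaming (_<?_ to _<ᶠ?_)
open import Data.Product using (Σ; _×_; _,_; ∃; ∃-syntax; proj₁; proj₂)
open import Data.Sum using ([_,_])
open import Relation.Nullary using (¬_; yes; no)
open import Relation.Nullary.Decidable using (_×-dec_)
open import Relation.Binary.PropositionalEquality using (_≡_; _≢_)
open import Relation.Binary.Construct.Closure.ReflexiveTransitive using (Star)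

-- A permutation of {0,…,n-1} (0-indexed version of {1,…,n}) is stored as
-- the vector of its values (one-line notation).
Perm : ℕ → Set
Perm n = Vec (Fin n) n

idP : ∀ {n} → Perm n
idP = tabulate (λ i → i)

infixl 7 _·_
_·_ : ∀ {n} → Perm n → Perm n → Perm n
x · y = tabulate (λ i → lookup x (lookup y i))

FPF : ∀ {n} → Perm n → Set
FPF {n} z = (∀ i → lookup z (lookup z i) ≡ i) × (∀ i → lookup z i ≢ i)

ℓ : ∀ {n} → Perm n → ℕ
ℓ {n} z = length (filter (λ p → (proj₁ p <ᶠ? proj₂ p) ×-dec (lookup z (proj₂ p) <ᶠ? lookup z (proj₁ p)))
                         (cartesianProduct (allFin n) (allFin n)))

trans : ∀ {n} → Fin n → Fin n → Perm n
trans a b = tabulate (transpose a b)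

BruhatStep : ∀ {n} → Perm n → Perm n → Set
BruhatStep {n} z y = Σ (Fin n) λ a → Σ (Fin n) λ b →
  a ≢ b × y ≡ trans a b · z · trans a b × ℓ z ≤ ℓ y

-- Bruhat order on 𝓕ₙ: the reflexive–transitive closure of BruhatStep
-- (starting from an element of 𝓕ₙ the closure stays in 𝓕ₙ)
_≤B_ : ∀ {n} → Perm n → Perm n → Set
_≤B_ = Star BruhatStep

-- simple transposition: for i : Fin n', s i is s_{i+1} in 1-indexed notation,
-- swapping positions i and i+1 (0-indexed)
s : ∀ {n'} → Fin n' → Perm (suc n')
s i = trans (inject₁ i) (F.suc i)

w₀ : ∀ {n} → Perm n
w₀ = tabulate opposite

-- embedding S_m ⊂ S_{m+2}, fixing the last two points (0-indexed m, m+1)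
extF : ∀ {m} → Perm m → Fin (suc (suc m)) → Fin (suc (suc m))
extF {m} z i with toℕ i ℕ.<? m
... | yes q = inject₁ (inject₁ (lookup z (fromℕ< q)))
... | no _ = i

ext : ∀ {m} → Perm m → Perm (suc (suc m))
ext z = tabulate (extF z)

-- s_{n-1} in S_n with n = m + 2 : swaps the last two points
sLast : ∀ {m} → Perm (suc (suc m))
sLast {m} = trans (inject₁ (F.fromℕ m)) (F.fromℕ (suc m))

ρ : ∀ {m} → Perm m → Perm (suc (suc m))
ρ z = w₀ · ext z · sLast · w₀

-- σ_j = s_j s_{j-1} ⋯ s_1   (j ≤ n-1 = n')
σ : ∀ {n'} (j : ℕ) → j ≤ n' → Perm (suc n')
σ zero _ = idP
σ (suc j) p = s (fromℕ< p) · σ j (<⇒≤ p)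

-- σ_j⁻¹ = s_1 s_2 ⋯ s_j
σ⁻¹ : ∀ {n'} (j : ℕ) → j ≤ n' → Perm (suc n')
σ⁻¹ zero _ = idP
σ⁻¹ (suc j) p = σ⁻¹ j (<⇒≤ p) · s (fromℕ< p)

-- Y₁ = ρₙ(𝓕_{n-2}),  n = m + 2 = suc (suc m)
Y₁ : (m : ℕ) → Perm (suc (suc m)) → Set
Y₁ m x = ∃[ z ] (FPF {m} z × x ≡ ρ z)

Y : (m j : ℕ) → j ≤ suc m → Perm (suc (suc m)) → Set
Y m j p x = ∃[ y ] (Y₁ m y × x ≡ σ j p · y · σ⁻¹ j p)

ν : (m j : ℕ) → j ≤ suc m → Perm (suc (suc m)) → Perm (suc (suc m))
ν m j p x = σ j p · x · σ⁻¹ j p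

{-# OPTIONS --safe #-}
-- Elements of Y₁ are fixed-point-free involutions exchanging the first two points, and
-- ν_{j+1}(x) = s_{j+1} ν_j(x) s_{j+1} with ν₁ = id on Y₁.  So ν_j is injective, Y_j is its image
-- by definition, and monotonicity reduces to one conjugation at a time: if j+1 is an ascent
-- (x(j+1) < x(j+2)) of both x ≤ y, then s_{j+1} x s_{j+1} ≤ s_{j+1} y s_{j+1}.  This follows from
-- the lifting property (x ≤ w, j+1 an ascent of x and a descent of w ⇒ s_{j+1} x s_{j+1} ≤ w),
-- proved along the chain of Bruhat steps from x to w.  The ascent condition holds because
-- ν_j(x) sends j+1 to 1, the least value.
module Submission where

open import Defs
open import Data.Nat as ℕ using (ℕ; zero; suc; _+_; _≤_; z≤n)
open import Data.Nat.Divisibility using (_∣_)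
open import Data.Nat.Properties as ℕ using (+-0-commutativeMonoid; +-mono-≤; +-mono-<-≤; +-comm; <⇒≤; <⇒≱)
open import Data.Fin as F using (Fin; toℕ; inject₁; fromℕ; fromℕ<; punchIn; punchOut; _<_)
open import Data.Fin.Properties as F using (_≟_; <-cmp; _<?_; punchIn-punchOut; punchInᵢ≢i; punchIn-injective)
open import Data.Fin.Permutation.Components using (transpose; transpose-inverse)
open import Function.Definitions using (Injective)
open import Data.List.Base as List using (_++_; length; filter)
open import Data.Vec using (lookup)
open import Data.Vec.Functional using (removeAt)
open import Data.Vec.Properties using (lookup∘tabulate; tabulate∘lookup; tabulate-cong)
open import Data.List.Properties using (filter-++; length-++)
open import Data.Product using (Σ; _×_; _,_; proj₂; ∃-syntax)
open import Data.Sum using (_⊎_; inj₁; inj₂)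
open import Data.Empty using (⊥-elim)
open import Function using (_∘_)
open import Relation.Nullary using (¬_; Dec; yes; no)
open import Relation.Nullary.Decidable using (_×-dec_)
open import Relation.Unary using (Pred; Decidable)
open import Relation.Binary using (tri<; tri≈; tri>)
open import Relation.Binary.Construct.Closure.ReflexiveTransitive using (ε; _◅_; _◅◅_)
open import Relation.Binary.PropositionalEquality
  using (_≡_; _≢_; refl; sym; cong; cong₂; subst; subst₂; _≗_; module ≡-Reasoning)
  renaming (trans to ≡-trans)
open import Algebra.Properties.CommutativeMonoid.Sum +-0-commutativeMonoid
  using (sum; sum-cong-≗; sum-remove; ∑-distrib-+)

sum-mono-≤ : ∀ {n} {f g : Fin n → ℕ} → (∀ i → f i ℕ.≤ g i) → sum f ℕ.≤ sum g
sum-mono-≤ {zero}  _   = z≤n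
sum-mono-≤ {suc n} f≤g = +-mono-≤ (f≤g F.zero) (sum-mono-≤ (f≤g ∘ F.suc))

module _ {n} {a b : Fin (suc (suc n))} (a≢b : a ≢ b) where

  sum-remove₂ : ∀ f → sum f ≡ f a + f b + sum (removeAt (removeAt f a) (punchOut a≢b))
  sum-remove₂ f = begin
    sum f                                          ≡⟨ sum-remove f ⟩
    f a + sum (removeAt f a)                       ≡⟨ cong (f a +_) (sum-remove (removeAt f a)) ⟩
    f a + (f (punchIn a (punchOut a≢b)) + rest)    ≡⟨ cong (λ c → f a + (f c + rest)) (punchIn-punchOut a≢b) ⟩
    f a + (f b + rest)                             ≡⟨ ℕ.+-assoc (f a) (f b) rest ⟨
    f a + f b + rest                               ∎
    where
    open ≡-Reasoning
    rest = sum (removeAt (removeAt f a) (punchOut a≢b))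

  sum-removeAt₂-mono : ∀ {f g} → (∀ j → j ≢ a → j ≢ b → f j ℕ.≤ g j) →
                       sum (removeAt (removeAt f a) (punchOut a≢b)) ℕ.≤ sum (removeAt (removeAt g a) (punchOut a≢b))
  sum-removeAt₂-mono f≤g = sum-mono-≤ λ j → f≤g _ (punchInᵢ≢i a _)
    (punchInᵢ≢i (punchOut a≢b) j ∘ punchIn-injective a _ _ ∘ λ e → ≡-trans e (sym (punchIn-punchOut a≢b)))

sum-mono-pair-≤ : ∀ {n} {a b : Fin n} {f g : Fin n → ℕ} → a ≢ b → (∀ j → j ≢ a → j ≢ b → f j ℕ.≤ g j) →
                  f a + f b ℕ.≤ g a + g b → sum f ℕ.≤ sum g
sum-mono-pair-≤ {suc zero} {F.zero} {F.zero} a≢b _ _ = ⊥-elim (a≢b refl)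
sum-mono-pair-≤ {suc (suc n)} {f = f} {g} a≢b off on =
  subst₂ ℕ._≤_ (sym (sum-remove₂ a≢b f)) (sym (sum-remove₂ a≢b g)) (+-mono-≤ on (sum-removeAt₂-mono a≢b off))

sum-mono-pair-< : ∀ {n} {a b : Fin n} {f g : Fin n → ℕ} → a ≢ b → (∀ j → j ≢ a → j ≢ b → f j ℕ.≤ g j) →
                  f a + f b ℕ.< g a + g b → sum f ℕ.< sum g
sum-mono-pair-< {suc zero} {F.zero} {F.zero} a≢b _ _ = ⊥-elim (a≢b refl)
sum-mono-pair-< {suc (suc n)} {f = f} {g} a≢b off on =
  subst₂ ℕ._<_ (sym (sum-remove₂ a≢b f)) (sym (sum-remove₂ a≢b g)) (+-mono-<-≤ on (sum-removeAt₂-mono a≢b off))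

𝟙 : ∀ {p} {P : Set p} → Dec P → ℕ
𝟙 (yes _) = 1
𝟙 (no _)  = 0

𝟙-mono : ∀ {p q} {P : Set p} {Q : Set q} → (P → Q) → (P? : Dec P) (Q? : Dec Q) → 𝟙 P? ℕ.≤ 𝟙 Q?
𝟙-mono P⇒Q (yes _) (yes _) = ℕ.≤-refl
𝟙-mono P⇒Q (yes p) (no ¬q) = ⊥-elim (¬q (P⇒Q p))
𝟙-mono P⇒Q (no _)  Q?      = z≤n

𝟙-mono₂ : ∀ {p q r s} {P₁ : Set p} {P₂ : Set q} {Q₁ : Set r} {Q₂ : Set s} → (P₁ → Q₁) → (P₂ → Q₂) →
          (P₁? : Dec P₁) (P₂? : Dec P₂) (Q₁? : Dec Q₁) (Q₂? : Dec Q₂) → 𝟙 P₁? + 𝟙 P₂? ℕ.≤ 𝟙 Q₁? + 𝟙 Q₂?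
𝟙-mono₂ f g P₁? P₂? Q₁? Q₂? = +-mono-≤ (𝟙-mono f P₁? Q₁?) (𝟙-mono g P₂? Q₂?)

𝟙-mono₂-swap : ∀ {p q r s} {P₁ : Set p} {P₂ : Set q} {Q₁ : Set r} {Q₂ : Set s} → (P₁ → Q₂) → (P₂ → Q₁) →
               (P₁? : Dec P₁) (P₂? : Dec P₂) (Q₁? : Dec Q₁) (Q₂? : Dec Q₂) → 𝟙 P₁? + 𝟙 P₂? ℕ.≤ 𝟙 Q₁? + 𝟙 Q₂?
𝟙-mono₂-swap f g P₁? P₂? Q₁? Q₂? = subst (𝟙 P₁? + 𝟙 P₂? ℕ.≤_) (+-comm (𝟙 Q₂?) (𝟙 Q₁?)) (𝟙-mono₂ f g P₁? P₂? Q₂? Q₁?)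

𝟙-no : ∀ {p} {P : Set p} → ¬ P → (P? : Dec P) → 𝟙 P? ≡ 0
𝟙-no ¬p (yes p) = ⊥-elim (¬p p)
𝟙-no ¬p (no _)  = refl

𝟙-yes : ∀ {p} {P : Set p} → P → (P? : Dec P) → 𝟙 P? ≡ 1
𝟙-yes p (yes _) = refl
𝟙-yes p (no ¬p) = ⊥-elim (¬p p)

length-filter-cartesianProduct : ∀ {a b p} {A : Set a} {B : Set b} {P : Pred (A × B) p} (P? : Decidable P)
  {m n} (f : Fin m → A) (g : Fin n → B) →
  length (filter P? (List.cartesianProduct (List.tabulate f) (List.tabulate g)))
    ≡ sum (λ i → sum (λ j → 𝟙 (P? (f i , g j))))
length-filter-cartesianProduct P? {zero} f g = refl
length-filter-cartesianProduct P? {suc m} f g = begin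
  length (filter P? (row ++ rest))                     ≡⟨ cong length (filter-++ P? row rest) ⟩
  length (filter P? row ++ filter P? rest)             ≡⟨ length-++ (filter P? row) ⟩
  length (filter P? row) + length (filter P? rest)     ≡⟨ cong₂ _+_ (length-filter-row g) (length-filter-cartesianProduct P? (f ∘ F.suc) g) ⟩
  sum (λ j → 𝟙 (P? (f F.zero , g j))) + sum (λ i → sum (λ j → 𝟙 (P? (f (F.suc i) , g j)))) ∎
  where
  open ≡-Reasoning
  row  = List.map (f F.zero ,_) (List.tabulate g)
  rest = List.cartesianProduct (List.tabulate (f ∘ F.suc)) (List.tabulate g)
  length-filter-row : ∀ {n} (h : Fin n → _) →
    length (filter P? (List.map (f F.zero ,_) (List.tabulate h))) ≡ sum (λ j → 𝟙 (P? (f F.zero , h j)))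
  length-filter-row {zero}  h = refl
  length-filter-row {suc n} h with P? (f F.zero , h F.zero)
  ... | yes _ = cong suc (length-filter-row (h ∘ F.suc))
  ... | no _  = length-filter-row (h ∘ F.suc)

transpose-matchˡ : ∀ {n} (a b : Fin n) → transpose a b a ≡ b
transpose-matchˡ a b with a ≟ a
... | yes _   = refl
... | no a≢a = ⊥-elim (a≢a refl)

transpose-matchʳ : ∀ {n} (a b : Fin n) → transpose a b b ≡ a
transpose-matchʳ a b with b ≟ a
... | yes b≡a = b≡a
... | no _ with b ≟ b
...   | yes _   = refl
...   | no b≢b = ⊥-elim (b≢b refl)

transpose-other : ∀ {n} {a b i : Fin n} → i ≢ a → i ≢ b → transpose a b i ≡ i
transpose-other {a = a} {b} {i} i≢a i≢b with i ≟ a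
... | yes i≡a = ⊥-elim (i≢a i≡a)
... | no _ with i ≟ b
...   | yes i≡b = ⊥-elim (i≢b i≡b)
...   | no _    = refl

data Position {n} (a b i : Fin n) : Set where
  at-a : i ≡ a → Position a b i
  at-b : i ≡ b → Position a b i
  away : i ≢ a → i ≢ b → Position a b i

position : ∀ {n} (a b i : Fin n) → Position a b i
position a b i with i ≟ a | i ≟ b
... | yes i≡a | _       = at-a i≡a
... | no _    | yes i≡b = at-b i≡b
... | no i≢a  | no i≢b  = away i≢a i≢b

transpose-comm : ∀ {n} (a b i : Fin n) → transpose a b i ≡ transpose b a i
transpose-comm a b i with position a b i
... | at-a refl     = ≡-trans (transpose-matchˡ i b) (sym (transpose-matchʳ b i))
... | at-b refl     = ≡-trans (transpose-matchʳ a i) (sym (transpose-matchˡ i a))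
... | away i≢a i≢b  = ≡-trans (transpose-other i≢a i≢b) (sym (transpose-other i≢b i≢a))

transpose-involutive : ∀ {n} (a b i : Fin n) → transpose a b (transpose a b i) ≡ i
transpose-involutive a b i = ≡-trans (cong (transpose a b) (transpose-comm a b i)) (transpose-inverse a b)

transpose-injective : ∀ {n} (a b : Fin n) → Injective _≡_ _≡_ (transpose a b)
transpose-injective a b {i} {j} tai≡taj =
  ≡-trans (sym (transpose-involutive a b i)) (≡-trans (cong (transpose a b) tai≡taj) (transpose-involutive a b j))

transpose-natural : ∀ {n} (g : Fin n → Fin n) → Injective _≡_ _≡_ g →
                    ∀ a b i → g (transpose a b i) ≡ transpose (g a) (g b) (g i)
transpose-natural g g-inj a b i with position a b i
... | at-a refl    = ≡-trans (cong g (transpose-matchˡ i b)) (sym (transpose-matchˡ (g i) (g b)))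
... | at-b refl    = ≡-trans (cong g (transpose-matchʳ a i)) (sym (transpose-matchʳ (g a) (g i)))
... | away i≢a i≢b = ≡-trans (cong g (transpose-other i≢a i≢b)) (sym (transpose-other (i≢a ∘ g-inj) (i≢b ∘ g-inj)))

Inversion : ∀ {n} → (Fin n → Fin n) → Fin n → Fin n → Set
Inversion w i j = i < j × w j < w i

inversion? : ∀ {n} (w : Fin n → Fin n) (i j : Fin n) → Dec (Inversion w i j)
inversion? w i j = (i <? j) ×-dec (w j <? w i)

inversions : ∀ {n} → (Fin n → Fin n) → ℕ
inversions w = sum λ i → sum λ j → 𝟙 (inversion? w i j)

ℓ≡inversions : ∀ {n} (x : Perm n) → ℓ x ≡ inversions (lookup x)
ℓ≡inversions x = length-filter-cartesianProduct (λ (i , j) → inversion? (lookup x) i j) (λ i → i) (λ j → j)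

inversions-cong : ∀ {n} {w v : Fin n → Fin n} → w ≗ v → inversions w ≡ inversions v
inversions-cong w≗v = sum-cong-≗ λ i → sum-cong-≗ λ j →
  cong₂ (λ wi wj → 𝟙 ((i <? j) ×-dec (wj <? wi))) (w≗v i) (w≗v j)

-- A row i ∉ {a, b} gains weakly once its columns a and b are taken together; rows a and b
-- taken together gain weakly in every column j ∉ {a, b}, and strictly in the block {a, b}²,
-- where (a , b) becomes an inversion.
module _ {n} (w : Fin n → Fin n) {a b : Fin n} (a<b : a < b) (wa<wb : w a < w b) where
  private
    t   = transpose a b
    a≢b = F.<⇒≢ a<b
    J   = λ i j → inversion? w i j
    J′  = λ i j → inversion? (w ∘ t) i j

    inversion′ : ∀ {i j u v} → i < j → w (t i) ≡ u → w (t j) ≡ v → v < u → Inversion (w ∘ t) i j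
    inversion′ i<j wti wtj v<u = i<j , subst₂ _<_ (sym wtj) (sym wti) v<u

    wt-a : w (t a) ≡ w b
    wt-a = cong w (transpose-matchˡ a b)
    wt-b : w (t b) ≡ w a
    wt-b = cong w (transpose-matchʳ a b)
    wt-away : ∀ {i} → i ≢ a → i ≢ b → w (t i) ≡ w i
    wt-away i≢a i≢b = cong w (transpose-other i≢a i≢b)

    row-away : ∀ i → i ≢ a → i ≢ b → sum (𝟙 ∘ J i) ℕ.≤ sum (𝟙 ∘ J′ i)
    row-away i i≢a i≢b = sum-mono-pair-≤ a≢b
      (λ j j≢a j≢b → 𝟙-mono (λ (i<j , wj<wi) → inversion′ i<j (wt-away i≢a i≢b) (wt-away j≢a j≢b) wj<wi) (J i j) (J′ i j))
      columns-ab
      where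
      columns-ab : 𝟙 (J i a) + 𝟙 (J i b) ℕ.≤ 𝟙 (J′ i a) + 𝟙 (J′ i b)
      columns-ab with <-cmp i a
      ... | tri≈ _ i≡a _ = ⊥-elim (i≢a i≡a)
      ... | tri< i<a _ _ = 𝟙-mono₂-swap
        (λ (_ , wa<wi) → inversion′ (F.<-trans i<a a<b) (wt-away i≢a i≢b) wt-b wa<wi)
        (λ (_ , wb<wi) → inversion′ i<a (wt-away i≢a i≢b) wt-a wb<wi)
        (J i a) (J i b) (J′ i a) (J′ i b)
      ... | tri> _ _ a<i = 𝟙-mono₂
        (λ (i<a , _) → ⊥-elim (F.<-asym i<a a<i))
        (λ (i<b , wb<wi) → inversion′ i<b (wt-away i≢a i≢b) wt-b (F.<-trans wa<wb wb<wi))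
        (J i a) (J i b) (J′ i a) (J′ i b)

    rows-ab : sum (𝟙 ∘ J a) + sum (𝟙 ∘ J b) ℕ.< sum (𝟙 ∘ J′ a) + sum (𝟙 ∘ J′ b)
    rows-ab = subst₂ ℕ._<_ (∑-distrib-+ (𝟙 ∘ J a) (𝟙 ∘ J b)) (∑-distrib-+ (𝟙 ∘ J′ a) (𝟙 ∘ J′ b))
      (sum-mono-pair-< a≢b columns-away columns-ab)
      where
      columns-away : ∀ j → j ≢ a → j ≢ b → 𝟙 (J a j) + 𝟙 (J b j) ℕ.≤ 𝟙 (J′ a j) + 𝟙 (J′ b j)
      columns-away j j≢a j≢b with <-cmp j a | <-cmp j b
      ... | tri≈ _ j≡a _ | _            = ⊥-elim (j≢a j≡a)
      ... | _            | tri≈ _ j≡b _ = ⊥-elim (j≢b j≡b)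
      ... | tri< j<a _ _ | _            = 𝟙-mono₂
        (λ (a<j , _) → ⊥-elim (F.<-asym a<j j<a))
        (λ (b<j , _) → ⊥-elim (F.<-asym b<j (F.<-trans j<a a<b)))
        (J a j) (J b j) (J′ a j) (J′ b j)
      ... | tri> _ _ a<j | tri< j<b _ _ = 𝟙-mono₂
        (λ (_ , wj<wa) → inversion′ a<j wt-a (wt-away j≢a j≢b) (F.<-trans wj<wa wa<wb))
        (λ (b<j , _) → ⊥-elim (F.<-asym b<j j<b))
        (J a j) (J b j) (J′ a j) (J′ b j)
      ... | tri> _ _ a<j | tri> _ _ b<j = 𝟙-mono₂-swap
        (λ (_ , wj<wa) → inversion′ b<j wt-b (wt-away j≢a j≢b) wj<wa)
        (λ (_ , wj<wb) → inversion′ a<j wt-a (wt-away j≢a j≢b) wj<wb)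
        (J a j) (J b j) (J′ a j) (J′ b j)
      columns-ab : 𝟙 (J a a) + 𝟙 (J b a) + (𝟙 (J a b) + 𝟙 (J b b)) ℕ.< 𝟙 (J′ a a) + 𝟙 (J′ b a) + (𝟙 (J′ a b) + 𝟙 (J′ b b))
      columns-ab = subst₂ ℕ._<_ (sym block≡0) refl
        (ℕ.≤-trans (ℕ.≤-reflexive (sym J′ab≡1)) (ℕ.≤-trans (ℕ.m≤m+n (𝟙 (J′ a b)) (𝟙 (J′ b b))) (ℕ.m≤n+m _ (𝟙 (J′ a a) + 𝟙 (J′ b a)))))
        where
        block≡0 : 𝟙 (J a a) + 𝟙 (J b a) + (𝟙 (J a b) + 𝟙 (J b b)) ≡ 0
        block≡0 = cong₂ _+_
          (cong₂ _+_ (𝟙-no (λ (a<a , _) → F.<-irrefl refl a<a) (J a a)) (𝟙-no (λ (b<a , _) → F.<-asym a<b b<a) (J b a)))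
          (cong₂ _+_ (𝟙-no (λ (_ , wb<wa) → F.<-asym wa<wb wb<wa) (J a b)) (𝟙-no (λ (b<b , _) → F.<-irrefl refl b<b) (J b b)))
        J′ab≡1 : 𝟙 (J′ a b) ≡ 1
        J′ab≡1 = 𝟙-yes (inversion′ a<b wt-a wt-b wa<wb) (J′ a b)

  inversions-transpose-< : inversions w ℕ.< inversions (w ∘ transpose a b)
  inversions-transpose-< = sum-mono-pair-< a≢b row-away rows-ab

Perm-ext : ∀ {n} {x y : Perm n} → lookup x ≗ lookup y → x ≡ y
Perm-ext {x = x} {y} x≗y = ≡-trans (sym (tabulate∘lookup x)) (≡-trans (tabulate-cong x≗y) (tabulate∘lookup y))

lookup-· : ∀ {n} (x y : Perm n) i → lookup (x · y) i ≡ lookup x (lookup y i)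
lookup-· x y = lookup∘tabulate _

lookup-trans : ∀ {n} (a b i : Fin n) → lookup (trans a b) i ≡ transpose a b i
lookup-trans a b = lookup∘tabulate _

Involution : ∀ {n} → Perm n → Set
Involution g = ∀ i → lookup g (lookup g i) ≡ i

involution-injective : ∀ {n} (g : Perm n) → Involution g → Injective _≡_ _≡_ (lookup g)
involution-injective g g² {i} {j} gi≡gj = ≡-trans (sym (g² i)) (≡-trans (cong (lookup g) gi≡gj) (g² j))

trans-involution : ∀ {n} (a b : Fin n) → Involution (trans a b)
trans-involution a b i = begin
  lookup (trans a b) (lookup (trans a b) i) ≡⟨ lookup-trans a b _ ⟩
  transpose a b (lookup (trans a b) i)      ≡⟨ cong (transpose a b) (lookup-trans a b i) ⟩
  transpose a b (transpose a b i)           ≡⟨ transpose-involutive a b i ⟩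
  i                                         ∎
  where open ≡-Reasoning

conj : ∀ {n} → Perm n → Perm n → Perm n
conj g x = g · x · g

lookup-·· : ∀ {n} (g x h : Perm n) i → lookup (g · x · h) i ≡ lookup g (lookup x (lookup h i))
lookup-·· g x h i = ≡-trans (lookup-· (g · x) h i) (lookup-· g x _)

lookup-conj : ∀ {n} (g x : Perm n) i → lookup (conj g x) i ≡ lookup g (lookup x (lookup g i))
lookup-conj g x = lookup-·· g x g

conj-involutive : ∀ {n} (g : Perm n) → Involution g → ∀ x → conj g (conj g x) ≡ x
conj-involutive g g² x = Perm-ext λ i → begin
  lookup (conj g (conj g x)) i                                       ≡⟨ lookup-conj g (conj g x) i ⟩
  lookup g (lookup (conj g x) (lookup g i))                          ≡⟨ cong (lookup g) (lookup-conj g x _) ⟩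
  lookup g (lookup g (lookup x (lookup g (lookup g i))))             ≡⟨ g² _ ⟩
  lookup x (lookup g (lookup g i))                                   ≡⟨ cong (lookup x) (g² i) ⟩
  lookup x i                                                         ∎
  where open ≡-Reasoning

conj-injective : ∀ {n} (g : Perm n) → Involution g → ∀ {x y} → conj g x ≡ conj g y → x ≡ y
conj-injective g g² {x} {y} gxg≡gyg =
  ≡-trans (sym (conj-involutive g g² x)) (≡-trans (cong (conj g) gxg≡gyg) (conj-involutive g g² y))

FPF-conj : ∀ {n} (g : Perm n) → Involution g → ∀ x → FPF x → FPF (conj g x)
FPF-conj g g² x (x² , x-nofix) = conj-involution , conj-nofix
  where
  open ≡-Reasoning
  conj-involution : Involution (conj g x)
  conj-involution i = begin
    lookup (conj g x) (lookup (conj g x) i)                    ≡⟨ lookup-conj g x _ ⟩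
    lookup g (lookup x (lookup g (lookup (conj g x) i)))       ≡⟨ cong (λ j → lookup g (lookup x (lookup g j))) (lookup-conj g x i) ⟩
    lookup g (lookup x (lookup g (lookup g (lookup x (lookup g i))))) ≡⟨ cong (lookup g ∘ lookup x) (g² _) ⟩
    lookup g (lookup x (lookup x (lookup g i)))                ≡⟨ cong (lookup g) (x² _) ⟩
    lookup g (lookup g i)                                      ≡⟨ g² i ⟩
    i                                                          ∎
  conj-nofix : ∀ i → lookup (conj g x) i ≢ i
  conj-nofix i gxgi≡i = x-nofix (lookup g i)
    (≡-trans (sym (g² _)) (cong (lookup g) (≡-trans (sym (lookup-conj g x i)) gxgi≡i)))

FPF-injective : ∀ {n} (x : Perm n) → FPF x → Injective _≡_ _≡_ (lookup x)
FPF-injective x (x² , _) = involution-injective x x²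

trans-comm : ∀ {n} (a b : Fin n) → trans a b ≡ trans b a
trans-comm a b = Perm-ext λ i → begin
  lookup (trans a b) i ≡⟨ lookup-trans a b i ⟩
  transpose a b i      ≡⟨ transpose-comm a b i ⟩
  transpose b a i      ≡⟨ lookup-trans b a i ⟨
  lookup (trans b a) i ∎
  where open ≡-Reasoning

lookup-conj-trans : ∀ {n} (a b : Fin n) (x : Perm n) i →
                    lookup (conj (trans a b) x) i ≡ transpose a b (lookup x (transpose a b i))
lookup-conj-trans a b x i = begin
  lookup (conj (trans a b) x) i                                   ≡⟨ lookup-conj (trans a b) x i ⟩
  lookup (trans a b) (lookup x (lookup (trans a b) i))            ≡⟨ lookup-trans a b _ ⟩
  transpose a b (lookup x (lookup (trans a b) i))                 ≡⟨ cong (transpose a b ∘ lookup x) (lookup-trans a b i) ⟩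
  transpose a b (lookup x (transpose a b i))                      ∎
  where open ≡-Reasoning

conj-conj-trans : ∀ {n} (g : Perm n) → Involution g → ∀ a b x →
                  conj g (conj (trans a b) x) ≡ conj (trans (lookup g a) (lookup g b)) (conj g x)
conj-conj-trans g g² a b x = Perm-ext λ i → begin
  lookup (conj g (conj (trans a b) x)) i      ≡⟨ lookup-conj g (conj (trans a b) x) i ⟩
  G (lookup (conj (trans a b) x) (G i))       ≡⟨ cong G (lookup-conj-trans a b x (G i)) ⟩
  G (T (X (T (G i))))                         ≡⟨ transpose-natural G G-inj a b _ ⟩
  T′ (G (X (T (G i))))                        ≡⟨ cong (λ j → T′ (G (X j))) (T∘G≡G∘T′ i) ⟩
  T′ (G (X (G (T′ i))))                       ≡⟨ cong T′ (lookup-conj g x (T′ i)) ⟨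
  T′ (lookup (conj g x) (T′ i))               ≡⟨ lookup-conj-trans _ _ (conj g x) i ⟨
  lookup (conj (trans (G a) (G b)) (conj g x)) i ∎
  where
  open ≡-Reasoning
  G = lookup g
  X = lookup x
  T = transpose a b
  T′ = transpose (G a) (G b)
  G-inj = involution-injective g g²
  T∘G≡G∘T′ : ∀ i → T (G i) ≡ G (T′ i)
  T∘G≡G∘T′ i = begin
    T (G i)            ≡⟨ g² _ ⟨
    G (G (T (G i)))    ≡⟨ cong G (transpose-natural G G-inj a b (G i)) ⟩
    G (T′ (G (G i)))   ≡⟨ cong (G ∘ T′) (g² i) ⟩
    G (T′ i)           ∎

module _ {n} (x : Perm n) (x² : Involution x) where
  private
    X     = lookup x
    X-inj = involution-injective x x²

  conj-trans-fix : ∀ {a b} → X a ≡ b → conj (trans a b) x ≡ x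
  conj-trans-fix {a} {b} xa≡b = Perm-ext λ i → begin
    lookup (conj (trans a b) x) i                  ≡⟨ lookup-conj-trans a b x i ⟩
    transpose a b (X (transpose a b i))            ≡⟨ cong (transpose a b) (transpose-natural X X-inj a b i) ⟩
    transpose a b (transpose (X a) (X b) (X i))    ≡⟨ cong (λ (c , d) → transpose a b (transpose c d (X i))) (cong₂ _,_ xa≡b xb≡a) ⟩
    transpose a b (transpose b a (X i))            ≡⟨ transpose-inverse a b ⟩
    X i                                            ∎
    where
    open ≡-Reasoning
    xb≡a : X b ≡ a
    xb≡a = ≡-trans (cong X (sym xa≡b)) (x² a)

  lookup-conj-trans-involution : ∀ a b i → lookup (conj (trans a b) x) i ≡ X (transpose (X a) (X b) (transpose a b i))
  lookup-conj-trans-involution a b i = begin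
    lookup (conj (trans a b) x) i                          ≡⟨ lookup-conj-trans a b x i ⟩
    transpose a b (X (transpose a b i))                    ≡⟨ cong₂ (λ c d → transpose c d (X (transpose a b i))) (x² a) (x² b) ⟨
    transpose (X (X a)) (X (X b)) (X (transpose a b i))    ≡⟨ transpose-natural X X-inj (X a) (X b) _ ⟨
    X (transpose (X a) (X b) (transpose a b i))            ∎
    where open ≡-Reasoning

-- (a b) x (a b) = x ∘ (x a  x b) ∘ (a b), and each of the two transpositions acts at an ascent.
ℓ-conj-trans-< : ∀ {n} (x : Perm n) → FPF x → ∀ {a b} → a < b → lookup x a < lookup x b →
                 ℓ x ℕ.< ℓ (conj (trans a b) x)
ℓ-conj-trans-< x (x² , x-nofix) {a} {b} a<b xa<xb = begin-strict
  ℓ x                                  ≡⟨ ℓ≡inversions x ⟩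
  inversions X                         <⟨ inversions-transpose-< X xa<xb xp<xq ⟩
  inversions (X ∘ t′)                  <⟨ inversions-transpose-< (X ∘ t′) a<b xt′a<xt′b ⟩
  inversions (X ∘ t′ ∘ t)              ≡⟨ inversions-cong (λ i → sym (lookup-conj-trans-involution x x² a b i)) ⟩
  inversions (lookup (conj (trans a b) x)) ≡⟨ ℓ≡inversions (conj (trans a b) x) ⟨
  ℓ (conj (trans a b) x)               ∎
  where
  open ℕ.≤-Reasoning
  X = lookup x
  t = transpose a b
  t′ = transpose (X a) (X b)
  xp<xq : X (X a) < X (X b)
  xp<xq = subst₂ _<_ (sym (x² a)) (sym (x² b)) a<b
  a≢xb : a ≢ X b
  a≢xb a≡xb = F.<-asym a<b (subst₂ _<_ (≡-trans (cong X a≡xb) (x² b)) (sym a≡xb) xa<xb)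
  b≢xa : b ≢ X a
  b≢xa b≡xa = F.<-asym a<b (subst₂ _<_ (sym b≡xa) (≡-trans (cong X b≡xa) (x² a)) xa<xb)
  xt′a<xt′b : X (t′ a) < X (t′ b)
  xt′a<xt′b = subst₂ _<_ (sym (cong X (transpose-other (x-nofix a ∘ sym) a≢xb)))
                         (sym (cong X (transpose-other b≢xa (x-nofix b ∘ sym)))) xa<xb

conj-trans-trivial-or-ascent : ∀ {n} (x : Perm n) → FPF x → ∀ {a b} → a < b → ℓ x ℕ.≤ ℓ (conj (trans a b) x) →
                               conj (trans a b) x ≡ x ⊎ lookup x a < lookup x b
conj-trans-trivial-or-ascent x fx@(x² , x-nofix) {a} {b} a<b ℓx≤ℓy with lookup x a ≟ b
... | yes xa≡b = inj₁ (conj-trans-fix x x² xa≡b)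
... | no xa≢b with <-cmp (lookup x a) (lookup x b)
...   | tri< xa<xb _ _ = inj₂ xa<xb
...   | tri≈ _ xa≡xb _ = ⊥-elim (F.<⇒≢ a<b (FPF-injective x fx xa≡xb))
...   | tri> _ _ xb<xa = ⊥-elim (<⇒≱ ℓy<ℓx ℓx≤ℓy)
  where
  X = lookup x
  t = transpose a b
  y = conj (trans a b) x
  ya≡xb : lookup y a ≡ X b
  ya≡xb = ≡-trans (lookup-conj-trans a b x a) (≡-trans (cong (t ∘ X) (transpose-matchˡ a b))
            (transpose-other (λ xb≡a → xa≢b (≡-trans (cong X (sym xb≡a)) (x² b))) (x-nofix b)))
  yb≡xa : lookup y b ≡ X a
  yb≡xa = ≡-trans (lookup-conj-trans a b x b) (≡-trans (cong (t ∘ X) (transpose-matchʳ a b))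
            (transpose-other (x-nofix a) xa≢b))
  ℓy<ℓx : ℓ y ℕ.< ℓ x
  ℓy<ℓx = subst (ℓ y ℕ.<_) (cong ℓ (conj-involutive (trans a b) (trans-involution a b) x))
    (ℓ-conj-trans-< y (FPF-conj (trans a b) (trans-involution a b) x fx) a<b (subst₂ _<_ (sym ya≡xb) (sym yb≡xa) xb<xa))

-- The lifting property at an adjacent transposition

BruhatStep-ordered : ∀ {n} {x z : Perm n} → BruhatStep x z →
                     Σ (Fin n) λ a → Σ (Fin n) λ b → a < b × z ≡ conj (trans a b) x × ℓ x ℕ.≤ ℓ z
BruhatStep-ordered {x = x} (a , b , a≢b , z≡ , ℓ≤) with <-cmp a b
... | tri< a<b _ _ = a , b , a<b , z≡ , ℓ≤
... | tri≈ _ a≡b _ = ⊥-elim (a≢b a≡b)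
... | tri> _ _ b<a = b , a , b<a , ≡-trans z≡ (cong (λ t → conj t x) (trans-comm a b)) , ℓ≤

module Adjacent {n} (f : Fin n) where

  k k′ : Fin (suc n)
  k  = inject₁ f
  k′ = F.suc f

  S : Fin (suc n) → Fin (suc n)
  S = transpose k k′

  k<k′ : k < k′
  k<k′ = F.≤̄⇒inject₁< F.≤-refl

  k<⇒k′≤ : ∀ {v : Fin (suc n)} → k < v → k′ F.≤ v
  k<⇒k′≤ {v} k<v = subst (ℕ._≤ toℕ v) (cong suc (F.toℕ-inject₁ f)) k<v

  <k′⇒≤k : ∀ {u : Fin (suc n)} → u < k′ → u F.≤ k
  <k′⇒≤k {u} u<k′ = subst (toℕ u ℕ.≤_) (sym (F.toℕ-inject₁ f)) (ℕ.≤-pred u<k′)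

  S-mono-< : ∀ {u v : Fin (suc n)} → u < v → ¬ (u ≡ k × v ≡ k′) → S u < S v
  S-mono-< {u} {v} u<v not-kk′ with position k k′ u | position k k′ v
  ... | at-a refl    | at-a refl    = ⊥-elim (F.<-irrefl refl u<v)
  ... | at-a refl    | at-b refl    = ⊥-elim (not-kk′ (refl , refl))
  ... | at-a refl    | away v≢k v≢k′ = subst₂ _<_ (sym (transpose-matchˡ k k′)) (sym (transpose-other v≢k v≢k′))
                                        (F.≤∧≢⇒< (k<⇒k′≤ u<v) (v≢k′ ∘ sym))
  ... | at-b refl    | at-a refl    = ⊥-elim (F.<-asym k<k′ u<v)
  ... | at-b refl    | at-b refl    = ⊥-elim (F.<-irrefl refl u<v)
  ... | at-b refl    | away v≢k v≢k′ = subst₂ _<_ (sym (transpose-matchʳ k k′)) (sym (transpose-other v≢k v≢k′))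
                                        (F.<-trans k<k′ u<v)
  ... | away u≢k u≢k′ | at-a refl   = subst₂ _<_ (sym (transpose-other u≢k u≢k′)) (sym (transpose-matchˡ k k′))
                                        (F.<-trans u<v k<k′)
  ... | away u≢k u≢k′ | at-b refl   = subst₂ _<_ (sym (transpose-other u≢k u≢k′)) (sym (transpose-matchʳ k k′))
                                        (F.≤∧≢⇒< (<k′⇒≤k u<v) u≢k)
  ... | away u≢k u≢k′ | away v≢k v≢k′ = subst₂ _<_ (sym (transpose-other u≢k u≢k′)) (sym (transpose-other v≢k v≢k′)) u<v

  s-involution : Involution (s f)
  s-involution = trans-involution k k′

  Ascent Descent : Perm (suc n) → Set
  Ascent  x = lookup x k < lookup x k′
  Descent x = lookup x k′ < lookup x k

  ascent-or-descent : ∀ x → FPF x → Ascent x ⊎ Descent x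
  ascent-or-descent x fx with <-cmp (lookup x k) (lookup x k′)
  ... | tri< asc _ _     = inj₁ asc
  ... | tri≈ _ xk≡xk′ _ = ⊥-elim (F.<⇒≢ k<k′ (FPF-injective x fx xk≡xk′))
  ... | tri> _ _ desc    = inj₂ desc

  lookup-conj-s : ∀ x i → lookup (conj (s f) x) (S i) ≡ S (lookup x i)
  lookup-conj-s x i = ≡-trans (lookup-conj-trans k k′ x (S i)) (cong (S ∘ lookup x) (transpose-involutive k k′ i))

  lookup-conj-s-k : ∀ x → lookup (conj (s f) x) k ≡ S (lookup x k′)
  lookup-conj-s-k x = ≡-trans (lookup-conj-trans k k′ x k) (cong (S ∘ lookup x) (transpose-matchˡ k k′))

  lookup-conj-s-k′ : ∀ x → lookup (conj (s f) x) k′ ≡ S (lookup x k)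
  lookup-conj-s-k′ x = ≡-trans (lookup-conj-trans k k′ x k′) (cong (S ∘ lookup x) (transpose-matchʳ k k′))

  descent-conj-s : ∀ x → FPF x → Ascent x → Descent (conj (s f) x)
  descent-conj-s x (_ , x-nofix) asc = subst₂ _<_ (sym (lookup-conj-s-k′ x)) (sym (lookup-conj-s-k x))
    (S-mono-< asc (λ (xk≡k , _) → x-nofix k xk≡k))

  ascent-step : ∀ x → FPF x → Ascent x → BruhatStep x (conj (s f) x)
  ascent-step x fx asc = k , k′ , F.<⇒≢ k<k′ , refl , <⇒≤ (ℓ-conj-trans-< x fx k<k′ asc)

  descent-step : ∀ x → FPF x → Descent x → BruhatStep (conj (s f) x) x
  descent-step x fx@(x² , x-nofix) desc =
    k , k′ , F.<⇒≢ k<k′ , sym (conj-involutive (s f) s-involution x) , ℓ-conj-s≤ℓ (lookup x k ≟ k′)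
    where
    y = conj (s f) x
    ℓ-conj-s≤ℓ : Dec (lookup x k ≡ k′) → ℓ y ℕ.≤ ℓ x
    ℓ-conj-s≤ℓ (yes xk≡k′) = ℕ.≤-reflexive (cong ℓ (conj-trans-fix x x² xk≡k′))
    ℓ-conj-s≤ℓ (no xk≢k′)  = subst (ℓ y ℕ.≤_) (cong ℓ (conj-involutive (s f) s-involution x))
      (<⇒≤ (ℓ-conj-trans-< y (FPF-conj (s f) s-involution x fx) k<k′
        (subst₂ _<_ (sym (lookup-conj-s-k x)) (sym (lookup-conj-s-k′ x)) (S-mono-< desc (xk≢k′ ∘ proj₂)))))

  conj-trans-adjacent : ∀ x → FPF x → ∀ {a b} → a < b → lookup x a ≡ k → lookup x b ≡ k′ →
                        conj (trans a b) x ≡ conj (s f) x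
  conj-trans-adjacent x fx@(x² , x-nofix) {a} {b} a<b xa≡k xb≡k′ = Perm-ext λ i → begin
    lookup (conj (trans a b) x) i   ≡⟨ lookup-conj-trans a b x i ⟩
    t (X (t i))                     ≡⟨ cong t (X∘t≡S∘X i) ⟩
    t (S (X i))                     ≡⟨ S∘t≡t∘S (X i) ⟨
    S (t (X i))                     ≡⟨ cong S (X∘S≡t∘X i) ⟨
    S (X (S i))                     ≡⟨ lookup-conj-trans k k′ x i ⟨
    lookup (conj (s f) x) i         ∎
    where
    open ≡-Reasoning
    X = lookup x
    t = transpose a b
    X-inj = FPF-injective x fx
    xk≡a : X k ≡ a
    xk≡a = ≡-trans (cong X (sym xa≡k)) (x² a)
    xk′≡b : X k′ ≡ b
    xk′≡b = ≡-trans (cong X (sym xb≡k′)) (x² b)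
    a≢k : a ≢ k
    a≢k a≡k = x-nofix k (≡-trans xk≡a a≡k)
    b≢k′ : b ≢ k′
    b≢k′ b≡k′ = x-nofix k′ (≡-trans xk′≡b b≡k′)
    a≢k′ : a ≢ k′
    a≢k′ a≡k′ = F.<-asym k<k′ (subst₂ _<_ a≡k′ (≡-trans (sym xk′≡b) (≡-trans (cong X (sym a≡k′)) xa≡k)) a<b)
    b≢k : b ≢ k
    b≢k b≡k = F.<-asym k<k′ (subst₂ _<_ (≡-trans (sym xk≡a) (≡-trans (cong X (sym b≡k)) xb≡k′)) b≡k a<b)
    X∘t≡S∘X : ∀ i → X (t i) ≡ S (X i)
    X∘t≡S∘X i = ≡-trans (transpose-natural X X-inj a b i) (cong₂ (λ c d → transpose c d (X i)) xa≡k xb≡k′)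
    X∘S≡t∘X : ∀ i → X (S i) ≡ t (X i)
    X∘S≡t∘X i = ≡-trans (transpose-natural X X-inj k k′ i) (cong₂ (λ c d → transpose c d (X i)) xk≡a xk′≡b)
    S∘t≡t∘S : ∀ i → S (t i) ≡ t (S i)
    S∘t≡t∘S i = ≡-trans (transpose-natural S (transpose-injective k k′) a b i)
                  (cong₂ (λ c d → transpose c d (S i)) (transpose-other a≢k a≢k′) (transpose-other b≢k b≢k′))

  conj-s-conj-trans : ∀ x a b → conj (s f) (conj (trans a b) x) ≡ conj (trans (S a) (S b)) (conj (s f) x)
  conj-s-conj-trans x a b = ≡-trans (conj-conj-trans (s f) s-involution a b x)
    (cong₂ (λ c d → conj (trans c d) (conj (s f) x)) (lookup-trans k k′ a) (lookup-trans k k′ b))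

  conj-s-step : ∀ x → FPF x → ∀ {a b} → a < b → lookup x a < lookup x b →
                ¬ (a ≡ k × b ≡ k′) → ¬ (lookup x a ≡ k × lookup x b ≡ k′) →
                BruhatStep (conj (s f) x) (conj (s f) (conj (trans a b) x))
  conj-s-step x fx {a} {b} a<b xa<xb ab≢kk′ xab≢kk′ =
    S a , S b , F.<⇒≢ Sa<Sb , conj-s-conj-trans x a b ,
    <⇒≤ (subst (λ z → ℓ y ℕ.< ℓ z) (sym (conj-s-conj-trans x a b))
      (ℓ-conj-trans-< y (FPF-conj (s f) s-involution x fx) Sa<Sb
        (subst₂ _<_ (sym (lookup-conj-s x a)) (sym (lookup-conj-s x b)) (S-mono-< xa<xb xab≢kk′))))
    where
    y = conj (s f) x
    Sa<Sb = S-mono-< a<b ab≢kk′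

  -- The step x → z is trivial, or is x → s x s itself, or commutes with conjugation by s,
  -- giving s x s → s z s; from s z s, w is reached by induction (ascent of z) or through z.
  lift-step : ∀ {x w a b} → FPF x → a < b → ℓ x ℕ.≤ ℓ (conj (trans a b) x) → conj (trans a b) x ≤B w →
              (FPF (conj (trans a b) x) → Ascent (conj (trans a b) x) → conj (s f) (conj (trans a b) x) ≤B w) →
              Ascent x → conj (s f) x ≤B w
  lift-step {x} {w} {a} {b} fx a<b ℓx≤ℓz z≤w lift-z asc with conj-trans-trivial-or-ascent x fx a<b ℓx≤ℓz
  ... | inj₁ z≡x = subst (λ y → conj (s f) y ≤B w) z≡x (lift-z fz (subst Ascent (sym z≡x) asc))
    where fz = FPF-conj (trans a b) (trans-involution a b) x fx
  ... | inj₂ xa<xb with (a ≟ k ×-dec b ≟ k′) | (lookup x a ≟ k ×-dec lookup x b ≟ k′)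
  ...   | yes (refl , refl) | _                   = z≤w
  ...   | no _              | yes (xa≡k , xb≡k′) = subst (_≤B w) (conj-trans-adjacent x fx a<b xa≡k xb≡k′) z≤w
  ...   | no ab≢kk′         | no xab≢kk′         =
    conj-s-step x fx a<b xa<xb ab≢kk′ xab≢kk′ ◅ conj-s-z≤w (ascent-or-descent z fz)
    where
    z  = conj (trans a b) x
    fz = FPF-conj (trans a b) (trans-involution a b) x fx
    conj-s-z≤w : Ascent z ⊎ Descent z → conj (s f) z ≤B w
    conj-s-z≤w (inj₁ asc-z)  = lift-z fz asc-z
    conj-s-z≤w (inj₂ desc-z) = descent-step z fz desc-z ◅ z≤w

  lift : ∀ {x w} → FPF x → x ≤B w → Ascent x → Descent w → conj (s f) x ≤B w
  lift fx ε asc desc = ⊥-elim (F.<-asym asc desc)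
  lift {x} fx (step ◅ z≤w) asc desc with BruhatStep-ordered {x = x} step
  ... | a , b , a<b , refl , ℓx≤ℓz =
    lift-step {x = x} fx a<b ℓx≤ℓz z≤w (λ fz asc-z → lift fz z≤w asc-z desc) asc

  conj-s-mono : ∀ {x y} → FPF x → FPF y → x ≤B y → Ascent x → Ascent y → conj (s f) x ≤B conj (s f) y
  conj-s-mono {y = y} fx fy x≤y asc-x asc-y =
    lift fx (x≤y ◅◅ (ascent-step y fy asc-y ◅ ε)) asc-x (descent-conj-s y fy asc-y)

-- The elements of Y₁ and their conjugates ν_j

data LastTwo {m} : Fin (suc (suc m)) → Set where
  low         : (v : Fin m) → LastTwo (inject₁ (inject₁ v))
  penultimate : LastTwo (inject₁ (fromℕ m))
  last        : LastTwo (fromℕ (suc m))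

lastTwo : ∀ {m} (i : Fin (suc (suc m))) → LastTwo i
lastTwo {zero}  F.zero           = penultimate
lastTwo {zero}  (F.suc F.zero)   = last
lastTwo {suc m} F.zero           = low F.zero
lastTwo {suc m} (F.suc i) with lastTwo i
... | low v       = low (F.suc v)
... | penultimate = penultimate
... | last        = last

module _ {m} (z : Perm m) where
  private
    pen : Fin (suc (suc m))
    pen = inject₁ (fromℕ m)
    lst : Fin (suc (suc m))
    lst = fromℕ (suc m)
    ι : Fin m → Fin (suc (suc m))
    ι v = inject₁ (inject₁ v)
    toℕ-ι : ∀ v → toℕ (ι v) ≡ toℕ v
    toℕ-ι v = ≡-trans (F.toℕ-inject₁ (inject₁ v)) (F.toℕ-inject₁ v)
    toℕ-pen : toℕ pen ≡ m
    toℕ-pen = ≡-trans (F.toℕ-inject₁ (fromℕ m)) (F.toℕ-fromℕ m)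
    ι≢pen : ∀ v → ι v ≢ pen
    ι≢pen v = F.fromℕ≢inject₁ ∘ sym ∘ F.inject₁-injective
    ι≢lst : ∀ v → ι v ≢ lst
    ι≢lst v = F.fromℕ≢inject₁ ∘ sym
    pen≢lst : pen ≢ lst
    pen≢lst = F.fromℕ≢inject₁ ∘ sym

    extF-low : ∀ v → extF z (ι v) ≡ ι (lookup z v)
    extF-low v with toℕ (ι v) ℕ.<? m
    ... | yes ιv<m = cong (ι ∘ lookup z) (F.toℕ-injective (≡-trans (F.toℕ-fromℕ< ιv<m) (toℕ-ι v)))
    ... | no ιv≮m  = ⊥-elim (ιv≮m (subst (ℕ._< m) (sym (toℕ-ι v)) (F.toℕ<n v)))

    extF-pen : extF z pen ≡ pen
    extF-pen with toℕ pen ℕ.<? m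
    ... | yes pen<m = ⊥-elim (ℕ.<-irrefl toℕ-pen pen<m)
    ... | no _      = refl

    extF-lst : extF z lst ≡ lst
    extF-lst with toℕ lst ℕ.<? m
    ... | yes lst<m = ⊥-elim (ℕ.<-asym (ℕ.n<1+n m) (subst (ℕ._< m) (F.toℕ-fromℕ (suc m)) lst<m))
    ... | no _      = refl

    E : Fin (suc (suc m)) → Fin (suc (suc m))
    E = lookup (ext z · sLast)

    lookup-ext·sLast : ∀ i → E i ≡ extF z (transpose pen lst i)
    lookup-ext·sLast i = ≡-trans (lookup-· (ext z) sLast i)
      (≡-trans (lookup∘tabulate (extF z) _) (cong (extF z) (lookup-trans pen lst i)))

    E-low : ∀ v → E (ι v) ≡ ι (lookup z v)
    E-low v = ≡-trans (lookup-ext·sLast (ι v)) (≡-trans (cong (extF z) (transpose-other (ι≢pen v) (ι≢lst v))) (extF-low v))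

    E-pen : E pen ≡ lst
    E-pen = ≡-trans (lookup-ext·sLast pen) (≡-trans (cong (extF z) (transpose-matchˡ pen lst)) extF-lst)

    E-lst : E lst ≡ pen
    E-lst = ≡-trans (lookup-ext·sLast lst) (≡-trans (cong (extF z) (transpose-matchʳ pen lst)) extF-pen)

  FPF-ext·sLast : FPF z → FPF (ext z · sLast)
  FPF-ext·sLast (z² , z-nofix) = E² , E-nofix
    where
    E² : ∀ i → E (E i) ≡ i
    E² i with lastTwo i
    ... | low v       = ≡-trans (cong E (E-low v)) (≡-trans (E-low (lookup z v)) (cong ι (z² v)))
    ... | penultimate = ≡-trans (cong E E-pen) E-lst
    ... | last        = ≡-trans (cong E E-lst) E-pen
    E-nofix : ∀ i → E i ≢ i
    E-nofix i with lastTwo i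
    ... | low v       = z-nofix v ∘ F.inject₁-injective ∘ F.inject₁-injective ∘ ≡-trans (sym (E-low v))
    ... | penultimate = pen≢lst ∘ sym ∘ ≡-trans (sym E-pen)
    ... | last        = pen≢lst ∘ ≡-trans (sym E-lst)

  ext·sLast-at-last : lookup (ext z · sLast) (fromℕ (suc m)) ≡ inject₁ (fromℕ m)
  ext·sLast-at-last = E-lst

w₀-involution : ∀ {n} → Involution (w₀ {n})
w₀-involution i = ≡-trans (lookup∘tabulate F.opposite (lookup w₀ i))
  (≡-trans (cong F.opposite (lookup∘tabulate F.opposite i)) (F.opposite-involutive i))

opposite-penultimate : ∀ m → F.opposite (inject₁ (fromℕ m)) ≡ F.suc (F.zero {m})
opposite-penultimate zero    = refl
opposite-penultimate (suc m) = cong inject₁ (opposite-penultimate m)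

ρ≡conj-w₀ : ∀ {m} (z : Perm m) → ρ z ≡ conj w₀ (ext z · sLast)
ρ≡conj-w₀ z = Perm-ext λ i → begin
  lookup (w₀ · ext z · sLast · w₀) i                              ≡⟨ lookup-· (w₀ · ext z · sLast) w₀ i ⟩
  lookup (w₀ · ext z · sLast) (lookup w₀ i)                       ≡⟨ lookup-· (w₀ · ext z) sLast (lookup w₀ i) ⟩
  lookup (w₀ · ext z) (lookup sLast (lookup w₀ i))                ≡⟨ lookup-· w₀ (ext z) (lookup sLast (lookup w₀ i)) ⟩
  lookup w₀ (lookup (ext z) (lookup sLast (lookup w₀ i)))         ≡⟨ cong (lookup w₀) (lookup-· (ext z) sLast (lookup w₀ i)) ⟨
  lookup w₀ (lookup (ext z · sLast) (lookup w₀ i))                ≡⟨ lookup-conj w₀ (ext z · sLast) i ⟨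
  lookup (conj w₀ (ext z · sLast)) i                              ∎
  where open ≡-Reasoning

Y₁⇒FPF : ∀ {m x} → Y₁ m x → FPF x
Y₁⇒FPF (z , fz , refl) = subst FPF (sym (ρ≡conj-w₀ z)) (FPF-conj w₀ w₀-involution (ext z · sLast) (FPF-ext·sLast z fz))

Y₁⇒0↦1 : ∀ {m x} → Y₁ m x → lookup x F.zero ≡ F.suc F.zero
Y₁⇒0↦1 {m} (z , fz , refl) = begin
  lookup (ρ z) F.zero                                            ≡⟨ cong (λ y → lookup y F.zero) (ρ≡conj-w₀ z) ⟩
  lookup (conj w₀ (ext z · sLast)) F.zero                        ≡⟨ lookup-conj w₀ (ext z · sLast) F.zero ⟩
  lookup w₀ (lookup (ext z · sLast) (lookup w₀ F.zero))          ≡⟨ lookup∘tabulate F.opposite (lookup (ext z · sLast) (lookup w₀ F.zero)) ⟩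
  F.opposite (lookup (ext z · sLast) (lookup w₀ F.zero))         ≡⟨ cong (F.opposite ∘ lookup (ext z · sLast)) (lookup∘tabulate F.opposite F.zero) ⟩
  F.opposite (lookup (ext z · sLast) (fromℕ (suc m)))            ≡⟨ cong F.opposite (ext·sLast-at-last z) ⟩
  F.opposite (inject₁ (fromℕ m))                                 ≡⟨ opposite-penultimate m ⟩
  F.suc F.zero                                                   ∎
  where open ≡-Reasoning

module _ (m : ℕ) where

  ν-zero : ∀ p x → ν m 0 p x ≡ x
  ν-zero p x = Perm-ext λ i → ≡-trans (lookup-·· idP x idP i)
    (≡-trans (lookup∘tabulate (λ j → j) _) (cong (lookup x) (lookup∘tabulate (λ j → j) i)))

  ν-suc : ∀ j (p : suc j ℕ.≤ suc m) x → ν m (suc j) p x ≡ conj (s (fromℕ< p)) (ν m j (<⇒≤ p) x)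
  ν-suc j p x = Perm-ext λ i → begin
    lookup (ν m (suc j) p x) i                         ≡⟨ lookup-·· (σ (suc j) p) x (σ⁻¹ (suc j) p) i ⟩
    lookup (s′ · σⱼ) (lookup x (lookup (σ⁻¹ⱼ · s′) i)) ≡⟨ lookup-· s′ σⱼ _ ⟩
    lookup s′ (lookup σⱼ (lookup x (lookup (σ⁻¹ⱼ · s′) i))) ≡⟨ cong (λ k → lookup s′ (lookup σⱼ (lookup x k))) (lookup-· σ⁻¹ⱼ s′ i) ⟩
    lookup s′ (lookup σⱼ (lookup x (lookup σ⁻¹ⱼ (lookup s′ i)))) ≡⟨ cong (lookup s′) (lookup-·· σⱼ x σ⁻¹ⱼ _) ⟨
    lookup s′ (lookup (ν m j (<⇒≤ p) x) (lookup s′ i)) ≡⟨ lookup-conj s′ (ν m j (<⇒≤ p) x) i ⟨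
    lookup (conj s′ (ν m j (<⇒≤ p) x)) i              ∎
    where
    open ≡-Reasoning
    s′   = s (fromℕ< p)
    σⱼ   = σ j (<⇒≤ p)
    σ⁻¹ⱼ = σ⁻¹ j (<⇒≤ p)

  ν-injective : ∀ j p {x y} → ν m j p x ≡ ν m j p y → x ≡ y
  ν-injective zero    p {x} {y} νx≡νy = ≡-trans (sym (ν-zero p x)) (≡-trans νx≡νy (ν-zero p y))
  ν-injective (suc j) p {x} {y} νx≡νy = ν-injective j (<⇒≤ p)
    (conj-injective (s (fromℕ< p)) (Adjacent.s-involution (fromℕ< p)) (≡-trans (sym (ν-suc j p x)) (≡-trans νx≡νy (ν-suc j p y))))

  FPF-ν : ∀ j p x → FPF x → FPF (ν m j p x)
  FPF-ν zero    p x fx = subst FPF (sym (ν-zero p x)) fx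
  FPF-ν (suc j) p x fx = subst FPF (sym (ν-suc j p x))
    (FPF-conj (s (fromℕ< p)) (Adjacent.s-involution (fromℕ< p)) (ν m j (<⇒≤ p) x) (FPF-ν j (<⇒≤ p) x fx))

  ν-one : ∀ p x → FPF x → lookup x F.zero ≡ F.suc F.zero → ν m 1 p x ≡ x
  ν-one p x (x² , _) x0≡1 =
    ≡-trans (ν-suc 0 p x) (≡-trans (cong (conj (s F.zero)) (ν-zero (<⇒≤ p) x)) (conj-trans-fix x x² x0≡1))

  inject₁-fromℕ< : ∀ {i} (p : suc (suc i) ℕ.≤ suc m) → inject₁ (fromℕ< p) ≡ F.suc (fromℕ< (<⇒≤ p))
  inject₁-fromℕ< p = F.toℕ-injective (≡-trans (F.toℕ-inject₁ (fromℕ< p))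
    (≡-trans (F.toℕ-fromℕ< p) (cong suc (sym (F.toℕ-fromℕ< (<⇒≤ p))))))

  ν-sends-j-to-0 : ∀ i (p : suc i ℕ.≤ suc m) x → FPF x → lookup x F.zero ≡ F.suc F.zero →
                   lookup (ν m (suc i) p x) (F.suc (fromℕ< p)) ≡ F.zero
  ν-sends-j-to-0 zero p x fx@(x² , _) x0≡1 = begin
    lookup (ν m 1 p x) (F.suc F.zero) ≡⟨ cong (λ y → lookup y (F.suc F.zero)) (ν-one p x fx x0≡1) ⟩
    lookup x (F.suc F.zero)           ≡⟨ cong (lookup x) x0≡1 ⟨
    lookup x (lookup x F.zero)        ≡⟨ x² F.zero ⟩
    F.zero                            ∎
    where open ≡-Reasoning
  ν-sends-j-to-0 (suc i) p x fx x0≡1 = begin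
    lookup (ν m (suc (suc i)) p x) k′   ≡⟨ cong (λ y → lookup y k′) (ν-suc (suc i) p x) ⟩
    lookup (conj (s f) u) k′           ≡⟨ lookup-conj-s-k′ u ⟩
    S (lookup u k)                     ≡⟨ cong (S ∘ lookup u) (inject₁-fromℕ< p) ⟩
    S (lookup u (F.suc (fromℕ< (<⇒≤ p)))) ≡⟨ cong S (ν-sends-j-to-0 i (<⇒≤ p) x fx x0≡1) ⟩
    S F.zero                           ≡⟨ transpose-other {b = k′} 0≢k (λ ()) ⟩
    F.zero                             ∎
    where
    open ≡-Reasoning
    f = fromℕ< p
    open Adjacent f
    u = ν m (suc i) (<⇒≤ p) x
    0≢k : F.zero ≢ k
    0≢k 0≡k with ≡-trans 0≡k (inject₁-fromℕ< p)
    ... | ()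

  ν-ascent : ∀ i (p : suc (suc i) ℕ.≤ suc m) x → FPF x → lookup x F.zero ≡ F.suc F.zero →
             Adjacent.Ascent (fromℕ< p) (ν m (suc i) (<⇒≤ p) x)
  ν-ascent i p x fx x0≡1 = subst (_< lookup u k′) (sym uk≡0) (F.≤∧≢⇒< z≤n (uk′≢0 ∘ sym))
    where
    open Adjacent (fromℕ< p)
    u = ν m (suc i) (<⇒≤ p) x
    uk≡0 : lookup u k ≡ F.zero
    uk≡0 = ≡-trans (cong (lookup u) (inject₁-fromℕ< p)) (ν-sends-j-to-0 i (<⇒≤ p) x fx x0≡1)
    uk′≢0 : lookup u k′ ≢ F.zero
    uk′≢0 uk′≡0 = F.<⇒≢ k<k′ (FPF-injective u (FPF-ν (suc i) (<⇒≤ p) x fx) (≡-trans uk≡0 (sym uk′≡0)))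

  ν-mono : ∀ i (p : suc i ℕ.≤ suc m) {x y} → FPF x → lookup x F.zero ≡ F.suc F.zero →
           FPF y → lookup y F.zero ≡ F.suc F.zero → x ≤B y → ν m (suc i) p x ≤B ν m (suc i) p y
  ν-mono zero p {x} {y} fx x0≡1 fy y0≡1 x≤y =
    subst₂ _≤B_ (sym (ν-one p x fx x0≡1)) (sym (ν-one p y fy y0≡1)) x≤y
  ν-mono (suc i) p {x} {y} fx x0≡1 fy y0≡1 x≤y =
    subst₂ _≤B_ (sym (ν-suc (suc i) p x)) (sym (ν-suc (suc i) p y))
      (Adjacent.conj-s-mono (fromℕ< p) (FPF-ν (suc i) (<⇒≤ p) x fx) (FPF-ν (suc i) (<⇒≤ p) y fy)
        (ν-mono i (<⇒≤ p) fx x0≡1 fy y0≡1 x≤y) (ν-ascent i p x fx x0≡1) (ν-ascent i p y fy y0≡1))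

mainTheorem10 : (m : ℕ) → 2 ≤ m → 2 ∣ suc (suc m) → (j : ℕ) → 1 ≤ j → (p : j ≤ suc m) →
    ((x : _) → Y₁ m x → Y m j p (ν m j p x))
    × ((x y : _) → Y₁ m x → Y₁ m y → ν m j p x ≡ ν m j p y → x ≡ y)
    × ((y : _) → Y m j p y → ∃[ x ] (Y₁ m x × ν m j p x ≡ y))
    × ((x y : _) → Y₁ m x → Y₁ m y → x ≤B y → ν m j p x ≤B ν m j p y)
mainTheorem10 m _ _ (suc i) _ p =
  (λ x x∈Y₁ → x , x∈Y₁ , refl) ,
  (λ x y _ _ → ν-injective m (suc i) p) ,
  (λ { y (x , x∈Y₁ , y≡νx) → x , x∈Y₁ , sym y≡νx }) ,
  (λ x y x∈Y₁ y∈Y₁ → ν-mono m i p (Y₁⇒FPF x∈Y₁) (Y₁⇒0↦1 x∈Y₁) (Y₁⇒FPF y∈Y₁) (Y₁⇒0↦1 y∈Y₁))
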